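{- Let $k$ be a positive integer. (i) If $k\equiv 1 \pmod 5$, then $va_3^{\equiv}(K_{4k,4k,4k})\leq \frac{12k+3}{5}$. (ii) If $k\equiv 2 \pmod 5$, then $va_3^{\equiv}(K_{4k,4k,4k})\leq \frac{12k+6}{5}$. (iii) If $k\equiv 3 \pmod 5$, then $va_3^{\equiv}(K_{4k,4k,4k})\leq \frac{12k+9}{5}$. (iv) If $k\equiv 4 \pmod 5$, then $va_3^{\equiv}(K_{4k,4k,4k})\leq \frac{12k+12}{5}$.
   Context: All graphs are finite and simple. A $t$-coloring of a graph $G$ is a map $f:V(G)\to\{1,\dots,t\}$, with color classes $V_i=\{v: f(v)=i\}$. It is equitable if $\big||V_i|-|V_j|\big|\le 1$ for all $i,j$. A $(t,k)$-tree-coloring of $G$ is a $t$-coloring such that every connected component of each induced subgraph $G[V_i]$ is a tree of maximum degree at most $k$; an equitable $(t,k)$-tree-coloring is a $(t,k)$-tree-coloring that is equitable. The strong equitable vertex $k$-arboricity $va_k^{\equiv}(G)$ is the smallest integer $t$ such that $G$ has an equitable $(t',k)$-tree-coloring for every integer $t'\ge t$. $K_{n,n,n}$ denotes the complete tripartite graph whose three partite sets each have exactly $n$ vertices. -}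

module Defs where

open import Data.Nat using (ℕ; zero; suc; _+_; _*_; _≤_)
open import Data.Bool using (Bool; true; false; not)
open import Data.Fin using (Fin; zero; suc; inject₁; fromℕ; quotient; _≟_)
open import Data.List using (List; length; filter)
open import Data.List.Base using ()
open import Data.Fin.Base using ()
open import Data.Vec.Functional using ()
open import Data.List using (allFin)
open import Data.Product using (Σ; _×_)
open import Function.Definitions using (Injective)
open import Relation.Binary.PropositionalEquality using (_≡_)
open import Relation.Nullary using (¬_)
open import Relation.Nullary.Decidable using (⌊_⌋)

record Graph : Set where
  field
    n     : ℕ
    adj   : Fin n → Fin n → Bool
    adj-sym : ∀ u v → adj u v ≡ adj v u
    irrefl : ∀ v → adj v v ≡ false

open Graph public

Coloring : Graph → ℕ → Set
Coloring G t = Fin (n G) → Fin t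

classSize : (G : Graph) {t : ℕ} → Coloring G t → Fin t → ℕ
classSize G f i = length (filter (λ v → f v ≟ i) (allFin (n G)))

Equitable : (G : Graph) {t : ℕ} → Coloring G t → Set
Equitable G f = ∀ i j → classSize G f i ≤ classSize G f j + 1

inducedDegree : (G : Graph) {t : ℕ} → Coloring G t → Fin (n G) → ℕ
inducedDegree G f v =
  length (filter (λ u → f u ≟ f v) (filter (λ u → Data.Bool.T? (adj G v u)) (allFin (n G))))
  where import Data.Bool

record Cycle (G : Graph) (l : ℕ) : Set where
  field
    c       : Fin (3 + l) → Fin (n G)
    inj     : Injective _≡_ _≡_ c
    step    : ∀ (j : Fin (2 + l)) → adj G (c (inject₁ j)) (c (suc j)) ≡ true
    close   : adj G (c (fromℕ (2 + l))) (c zero) ≡ true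

MonoCycle : (G : Graph) {t : ℕ} → Coloring G t → Fin t → Set
MonoCycle G f i = Σ ℕ λ l → Σ (Cycle G l) λ C → ∀ j → f (Cycle.c C j) ≡ i

-- (t,k)-tree-coloring: every component of each G[V_i] is a tree (i.e. G[V_i]
-- is acyclic) of maximum degree at most k.
TreeColoring : (G : Graph) (t k : ℕ) → Coloring G t → Set
TreeColoring G t k f = (∀ i → ¬ MonoCycle G f i) × (∀ v → inducedDegree G f v ≤ k)

HasEquitableTreeColoring : Graph → (t k : ℕ) → Set
HasEquitableTreeColoring G t k =
  Σ (Coloring G t) λ f → TreeColoring G t k f × Equitable G f

-- va_k^≡(G) ≤ b.  Since va_k^≡(G) is the least t such that G has an
-- equitable (t',k)-tree-coloring for all t' ≥ t, this holds iff
-- G has an equitable (t',k)-tree-coloring for every t' ≥ b.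
StrongEqVertexArboricityAtMost : Graph → (k b : ℕ) → Set
StrongEqVertexArboricityAtMost G k b = ∀ t' → b ≤ t' → HasEquitableTreeColoring G t' k

K3 : ℕ → Graph
K3 m = record
  { n = 3 * m
  ; adj = λ u v → not ⌊ quotient {3} m u ≟ quotient {3} m v ⌋
  ; adj-sym = λ u v → symAdj u v
  ; irrefl = λ v → irr v
  }
  where
  open import Relation.Nullary using (yes; no)
  open import Relation.Binary.PropositionalEquality using (refl; sym)
  symAdj : ∀ u v → not ⌊ quotient {3} m u ≟ quotient {3} m v ⌋ ≡ not ⌊ quotient {3} m v ≟ quotient {3} m u ⌋
  symAdj u v with quotient {3} m u ≟ quotient {3} m v | quotient {3} m v ≟ quotient {3} m u
  ... | yes _ | yes _ = refl
  ... | no _ | no _ = refl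
  ... | yes p | no q with q (sym p)
  ... | ()
  symAdj u v | no p | yes q with p (sym q)
  ... | ()
  irr : ∀ v → not ⌊ quotient {3} m v ≟ quotient {3} m v ⌋ ≡ false
  irr v with quotient {3} m v ≟ quotient {3} m v
  ... | yes _ = refl
  ... | no q with q refl
  ... | ()

-- Number the vertices of K_{N,N,N} by 0, …, 3N − 1, so that the parts are the intervals
-- [pN, (p + 1)N), and colour by cutting this line into consecutive blocks of sizes Q and Q + 1,
-- which is automatically equitable. A block inside a part is independent, and a block of at most
-- three vertices with a single vertex on one side of a part boundary induces a star; in such a
-- colouring every monochromatic edge meets the centre of its class, so there are no monochromatic
-- cycles and degrees are at most 3. Writing t = 3m + e, blocks fitting inside the parts exist
-- unless N = c + (Q + 1)m with 1 ≤ c ≤ Q, where Q = ⌊N/(m + 1)⌋. For N = 4k, k ≡ ρ (mod 5) and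
-- 5t ≥ 12k + 3ρ, this forces Q = 2 (Q ≥ 5 contradicts the bound on t, Q = 4 the congruence
-- 5 ∣ N + ρ, and Q ∈ {1, 3} the divisibility 4 ∣ N), and then two blocks straddling the part
-- boundaries as stars repair the layout.
module Submission where

open import Defs
open import Data.Bool using (T; T?; true; false; if_then_else_)
open import Data.Bool.Properties using (T-≡)
open import Data.Empty using (⊥; ⊥-elim)
open import Data.Fin as Fin using (Fin; zero; suc; toℕ; fromℕ<; quotient; remainder)
open import Data.Fin.Properties using (toℕ-injective; toℕ-fromℕ<; toℕ<n; combine-remQuot; toℕ-combine)
open import Data.List using (List; []; _∷_; _++_; length; replicate; filter; allFin; tabulate)
open import Data.List.Membership.Propositional using (_∈_)
open import Data.List.Membership.Propositional.Properties using (∈-filter⁻)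
open import Data.List.Properties using (length-++; length-replicate)
open import Data.List.Relation.Binary.Sublist.Propositional.Properties using (filter⁺; filter-⊆; length-mono-≤)
open import Data.List.Relation.Unary.All using (All; []; _∷_)
open import Data.List.Relation.Unary.All.Properties using (++⁺; replicate⁺)
open import Data.List.Relation.Unary.Any using (here)
open import Data.Nat using (ℕ; zero; suc; _+_; _*_; _∸_; _≤_; _<_; z≤n; s≤s; _/_; _%_; _≡ᵇ_; NonZero; >-nonZero)
open import Data.Nat.Divisibility using (_∣_; divides; ∣-trans; ∣⇒≤; ∣m+n∣m⇒∣n; m∣m*n; n∣m*n)
open import Data.Nat.DivMod using (m≡m%n+[m/n]*n; m%n<n; m/n*n≤m; m/n*n≡m)
open import Data.Nat.ListAction using (sum)
open import Data.Nat.ListAction.Properties using (sum-++)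
open import Data.Nat.Properties
open import Data.Nat.Tactic.RingSolver using (solve-∀)
open import Data.Product using (Σ; _×_; _,_; proj₁; proj₂)
open import Data.Sum using (_⊎_; inj₁; inj₂; map₂)
open import Data.Unit using (tt)
open import Function using (_∘_; id)
open import Function.Bundles using (Equivalence)
open import Relation.Nullary using (¬_; yes; no)
open import Relation.Binary.PropositionalEquality
  using (_≡_; _≢_; refl; sym; trans; cong; cong₂; subst; subst₂; module ≡-Reasoning)

-- Colourings whose classes induce stars

secondNeighbour : ∀ {G l} (C : Cycle G l) → let open Cycle C in
                  Σ (Fin (3 + l)) λ w → suc zero ≢ w × adj G (c (suc (suc zero))) (c w) ≡ true
secondNeighbour {l = zero} C = zero , (λ ()) , Cycle.close C
secondNeighbour {l = suc _} C = suc (suc (suc zero)) , (λ ()) , Cycle.step C (suc (suc zero))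

module _ (G : Graph) {t : ℕ} (f : Coloring G t) where

  inducedDegree≤classSize : ∀ v → inducedDegree G f v ≤ classSize G f (f v)
  inducedDegree≤classSize v =
    length-mono-≤ (filter⁺ (λ u → f u Fin.≟ f v) (λ u → f u Fin.≟ f v) (λ { refl p → p })
                           (filter-⊆ (λ u → T? (adj G v u)) (allFin (n G))))

  module _ (Z : Fin (n G) → Set)
           (covers : ∀ u v → f u ≡ f v → adj G u v ≡ true → Z u ⊎ Z v)
           (unique : ∀ u v → Z u → Z v → f u ≡ f v → u ≡ v) where

    -- Each of the consecutive edges c 0 c 1, c 1 c 2, c 2 w of a monochromatic cycle contains a
    -- centre, which forces two distinct centres of one colour.
    centred⇒¬MonoCycle : ∀ i → ¬ MonoCycle G f i
    centred⇒¬MonoCycle i (l , C , mono) = refute (secondNeighbour C)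
      where
      open Cycle C
      two : Fin (3 + l)
      two = suc (suc zero)

      sameColour : ∀ x y → f (c x) ≡ f (c y)
      sameColour x y = trans (mono x) (sym (mono y))

      centreOn : ∀ x y → adj G (c x) (c y) ≡ true → Z (c x) ⊎ Z (c y)
      centreOn x y = covers (c x) (c y) (sameColour x y)

      twoCentres : ∀ x y → x ≢ y → Z (c x) → Z (c y) → ⊥
      twoCentres x y x≢y zx zy = x≢y (inj (unique (c x) (c y) zx zy (sameColour x y)))

      refute : (Σ (Fin (3 + l)) λ w → suc zero ≢ w × adj G (c two) (c w) ≡ true) → ⊥
      refute (w , 1≢w , c₂~w) with centreOn zero (suc zero) (step zero)
      ... | inj₁ z₀ with centreOn (suc zero) two (step (suc zero))
      ...   | inj₁ z₁ = twoCentres zero (suc zero) (λ ()) z₀ z₁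
      ...   | inj₂ z₂ = twoCentres zero two (λ ()) z₀ z₂
      refute (w , 1≢w , c₂~w) | inj₂ z₁ with centreOn two w c₂~w
      ...   | inj₁ z₂ = twoCentres (suc zero) two (λ ()) z₁ z₂
      ...   | inj₂ z_w = twoCentres (suc zero) w 1≢w z₁ z_w

    centred⇒TreeColoring : (∀ u v → f u ≡ f v → adj G u v ≡ true → classSize G f (f u) ≤ 3) →
                           TreeColoring G t 3 f
    centred⇒TreeColoring small = centred⇒¬MonoCycle , degree≤3
      where
      degree≤3 : ∀ v → inducedDegree G f v ≤ 3
      degree≤3 v with filter (λ u → f u Fin.≟ f v) (filter (λ u → T? (adj G v u)) (allFin (n G))) in eq
      ... | [] = z≤n
      ... | u ∷ _ = ≤-trans (subst (λ us → length us ≤ classSize G f (f v)) eq (inducedDegree≤classSize v))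
                            (small v u (sym (proj₂ u∈)) (Equivalence.to T-≡ v~u))
        where
        neighbours = filter (λ u → T? (adj G v u)) (allFin (n G))
        u∈ : u ∈ neighbours × f u ≡ f v
        u∈ = ∈-filter⁻ (λ u → f u Fin.≟ f v) {xs = neighbours} (subst (u ∈_) (sym eq) (here refl))
        v~u = proj₂ (∈-filter⁻ (λ u → T? (adj G v u)) {xs = allFin (n G)} (proj₁ u∈))

-- Cutting ℕ into consecutive blocks

blockOf : List ℕ → ℕ → ℕ
blockOf [] _ = 0
blockOf (zero ∷ L) w = suc (blockOf L w)
blockOf (suc l ∷ L) zero = 0
blockOf (suc l ∷ L) (suc w) = blockOf (l ∷ L) w

nth : List ℕ → ℕ → ℕ
nth [] _ = 0
nth (x ∷ _) zero = x
nth (_ ∷ L) (suc j) = nth L j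

blockOf-head : ∀ {l} L w → w < l → blockOf (l ∷ L) w ≡ 0
blockOf-head {suc l} L zero _ = refl
blockOf-head {suc l} L (suc w) (s≤s w<l) = blockOf-head L w w<l

blockOf-tail : ∀ l L d → blockOf (l ∷ L) (l + d) ≡ suc (blockOf L d)
blockOf-tail zero L d = refl
blockOf-tail (suc l) L d = blockOf-tail l L d

blockOf<length : ∀ L w → w < sum L → blockOf L w < length L
blockOf<length (zero ∷ L) w w< = s≤s (blockOf<length L w w<)
blockOf<length (suc l ∷ L) zero _ = s≤s z≤n
blockOf<length (suc l ∷ L) (suc w) (s≤s w<) = blockOf<length (l ∷ L) w w<

occurrences : (ℕ → ℕ) → ℕ → ℕ → ℕ
occurrences h zero j = 0
occurrences h (suc M) j = (if h 0 ≡ᵇ j then 1 else 0) + occurrences (h ∘ suc) M j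

occurrences-suc : ∀ h M j → occurrences (suc ∘ h) M (suc j) ≡ occurrences h M j
occurrences-suc h zero j = refl
occurrences-suc h (suc M) j = cong ((if h 0 ≡ᵇ j then 1 else 0) +_) (occurrences-suc (h ∘ suc) M j)

occurrences-suc-zero : ∀ h M → occurrences (suc ∘ h) M 0 ≡ 0
occurrences-suc-zero h zero = refl
occurrences-suc-zero h (suc M) = occurrences-suc-zero (h ∘ suc) M

occurrences-blockOf-∷ : ∀ l L j → occurrences (blockOf (l ∷ L)) (l + sum L) j ≡ nth (l ∷ L) j
occurrences-blockOf-∷ zero [] zero = refl
occurrences-blockOf-∷ zero [] (suc j) = refl
occurrences-blockOf-∷ zero (l ∷ L) zero = occurrences-suc-zero (blockOf (l ∷ L)) (l + sum L)
occurrences-blockOf-∷ zero (l ∷ L) (suc j) =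
  trans (occurrences-suc (blockOf (l ∷ L)) (l + sum L) j) (occurrences-blockOf-∷ l L j)
occurrences-blockOf-∷ (suc l) L zero = cong suc (occurrences-blockOf-∷ l L zero)
occurrences-blockOf-∷ (suc l) L (suc j) = occurrences-blockOf-∷ l L (suc j)

occurrences-blockOf : ∀ L j → occurrences (blockOf L) (sum L) j ≡ nth L j
occurrences-blockOf [] j = refl
occurrences-blockOf (l ∷ L) j = occurrences-blockOf-∷ l L j

length-filter-tabulate : ∀ {A : Set} {M t} (a : A → Fin t) (g : Fin M → A) (h : ℕ → ℕ) (i : Fin t) →
                         (∀ x → toℕ (a (g x)) ≡ h (toℕ x)) →
                         length (filter (λ v → a v Fin.≟ i) (tabulate g)) ≡ occurrences h M (toℕ i)
length-filter-tabulate {M = zero} a g h i a∘g≗h = refl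
length-filter-tabulate {M = suc M} a g h i a∘g≗h with a (g zero) Fin.≟ i | h 0 ≡ᵇ toℕ i in eq
... | yes _ | true = cong suc (length-filter-tabulate a (g ∘ suc) (h ∘ suc) i (a∘g≗h ∘ suc))
... | no _ | false = length-filter-tabulate a (g ∘ suc) (h ∘ suc) i (a∘g≗h ∘ suc)
... | yes a₀≡i | false =
  ⊥-elim (subst T eq (≡⇒≡ᵇ (h 0) (toℕ i) (trans (sym (a∘g≗h zero)) (cong toℕ a₀≡i))))
... | no a₀≢i | true =
  ⊥-elim (a₀≢i (toℕ-injective (trans (a∘g≗h zero) (≡ᵇ⇒≡ (h 0) (toℕ i) (subst T (sym eq) tt)))))

-- Parts of K3 N and blocks inducing stars

InPart : ℕ → ℕ → ℕ → Set
InPart N p w = p * N ≤ w × w < p * N + N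

part-unique : ∀ {N q r p} → r < N → InPart N p (N * q + r) → q ≡ p
part-unique {N} {q} {r} {p} r<N (lo , hi) = ≤-antisym (≤-pred q<1+p) (≤-pred p<1+q)
  where
  open ≤-Reasoning
  q<1+p : q < suc p
  q<1+p = *-cancelʳ-< N q (suc p) (begin-strict
    q * N         ≡⟨ *-comm q N ⟩
    N * q         ≤⟨ m≤m+n (N * q) r ⟩
    N * q + r     <⟨ hi ⟩
    p * N + N     ≡⟨ +-comm (p * N) N ⟩
    suc p * N     ∎)
  p<1+q : p < suc q
  p<1+q = *-cancelʳ-< N p (suc q) (begin-strict
    p * N         ≤⟨ lo ⟩
    N * q + r     <⟨ +-monoʳ-< (N * q) r<N ⟩
    N * q + N     ≡⟨ +-comm (N * q) N ⟩
    N + N * q     ≡⟨ sym (*-suc N q) ⟩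
    N * suc q     ≡⟨ *-comm N (suc q) ⟩
    suc q * N     ∎)

InPart⇒quotient : ∀ N (v : Fin (3 * N)) p → InPart N p (toℕ v) → toℕ (quotient {3} N v) ≡ p
InPart⇒quotient N v p v∈p = part-unique (toℕ<n r) (subst (InPart N p) v≡ v∈p)
  where
  q = quotient {3} N v
  r = remainder {3} N v
  v≡ : toℕ v ≡ N * toℕ q + toℕ r
  v≡ = trans (cong toℕ (sym (combine-remQuot {3} N v))) (toℕ-combine q r)

samePart⇒nonadjacent : ∀ N (u v : Fin (3 * N)) p → InPart N p (toℕ u) → InPart N p (toℕ v) →
                       adj (K3 N) u v ≡ false
samePart⇒nonadjacent N u v p u∈p v∈p with quotient {3} N u Fin.≟ quotient {3} N v
... | yes _ = refl
... | no u≢v =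
  ⊥-elim (u≢v (toℕ-injective (trans (InPart⇒quotient N u p u∈p) (sym (InPart⇒quotient N v p v∈p)))))

-- The vertices s, …, s + l − 1 of K3 N other than `centre` lie in one part, so they induce a star
-- centred at `centre`, or no edge at all.
record StarBlock (N s l : ℕ) : Set where
  field
    centre part : ℕ
    offCentre   : ∀ d → d < l → s + d ≢ centre → InPart N part (s + d)
    smallOrFlat : l ≤ 3 ⊎ (∀ d → d < l → InPart N part (s + d))

data StarLayout (N : ℕ) : ℕ → List ℕ → Set where
  [] : ∀ {s} → StarLayout N s []
  _∷_ : ∀ {s l L} → StarBlock N s l → StarLayout N (s + l) L → StarLayout N s (l ∷ L)

module _ {N : ℕ} where

  centreOf partOf : ∀ {s L} → StarLayout N s L → ℕ → ℕ
  centreOf [] _ = 0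
  centreOf (B ∷ _) zero = StarBlock.centre B
  centreOf (_ ∷ Bs) (suc j) = centreOf Bs j
  partOf [] _ = 0
  partOf (B ∷ _) zero = StarBlock.part B
  partOf (_ ∷ Bs) (suc j) = partOf Bs j

  PlacedIn : ∀ {s L} → StarLayout N s L → ℕ → ℕ → Set
  PlacedIn {L = L} Bs j w = (w ≢ centreOf Bs j → InPart N (partOf Bs j) w)
                          × (nth L j ≤ 3 ⊎ InPart N (partOf Bs j) w)

  placedIn-blockOf : ∀ {s L} (Bs : StarLayout N s L) w → w < sum L → PlacedIn Bs (blockOf L w) (s + w)
  placedIn-blockOf {s} {l ∷ L} (B ∷ Bs) w w< with w <? l
  ... | yes w<l rewrite blockOf-head L w w<l =
    StarBlock.offCentre B w w<l , map₂ (λ inPart → inPart w w<l) (StarBlock.smallOrFlat B)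
  ... | no w≮l = subst (λ w → PlacedIn (B ∷ Bs) (blockOf (l ∷ L) w) (s + w)) (m+[n∸m]≡n l≤w) placed
    where
    l≤w = ≮⇒≥ w≮l
    d = w ∸ l
    d< : d < sum L
    d< = +-cancelˡ-< l d (sum L) (subst (_< l + sum L) (sym (m+[n∸m]≡n l≤w)) w<)
    placed : PlacedIn (B ∷ Bs) (blockOf (l ∷ L) (l + d)) (s + (l + d))
    placed = subst₂ (PlacedIn (B ∷ Bs)) (sym (blockOf-tail l L d)) (+-assoc s l d) (placedIn-blockOf Bs d d<)

  StarLayout-++ : ∀ {s L₁ L₂} → StarLayout N s L₁ → StarLayout N (s + sum L₁) L₂ →
                  StarLayout N s (L₁ ++ L₂)
  StarLayout-++ {s} {L₂ = L₂} [] Bs₂ = subst (λ s → StarLayout N s L₂) (+-identityʳ s) Bs₂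
  StarLayout-++ {s} {l ∷ L₁} {L₂} (B ∷ Bs₁) Bs₂ =
    B ∷ StarLayout-++ Bs₁ (subst (λ s → StarLayout N s L₂) (sym (+-assoc s l (sum L₁))) Bs₂)

  StarLayout-inPart : ∀ p {s} L → p * N ≤ s → s + sum L ≤ p * N + N → StarLayout N s L
  StarLayout-inPart p [] _ _ = []
  StarLayout-inPart p {s} (l ∷ L) lo hi =
    block ∷ StarLayout-inPart p L (≤-trans lo (m≤m+n s l))
                                  (subst (_≤ p * N + N) (sym (+-assoc s l (sum L))) hi)
    where
    inPart : ∀ d → d < l → InPart N p (s + d)
    inPart d d<l = ≤-trans lo (m≤m+n s d) , (begin-strict
      s + d           <⟨ +-monoʳ-< s d<l ⟩
      s + l           ≤⟨ m≤m+n (s + l) (sum L) ⟩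
      s + l + sum L   ≡⟨ +-assoc s l (sum L) ⟩
      s + (l + sum L) ≤⟨ hi ⟩
      p * N + N       ∎)
      where open ≤-Reasoning
    block : StarBlock N s l
    block = record { centre = s ; part = p ; offCentre = λ d d<l _ → inPart d d<l ; smallOrFlat = inj₂ inPart }

  StarBlock-centredAtStart : ∀ p {s a b} → s + a ≡ p * N + N → a ≤ 1 → b ≤ N → a + b ≤ 3 →
                             StarBlock N s (a + b)
  StarBlock-centredAtStart p {s} {a} {b} s+a≡ a≤1 b≤N size≤3 =
    record { centre = s ; part = suc p ; offCentre = offCentre ; smallOrFlat = inj₁ size≤3 }
    where
    open ≤-Reasoning
    offCentre : ∀ d → d < a + b → s + d ≢ s → InPart N (suc p) (s + d)
    offCentre d d< s+d≢s = (begin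
      N + p * N       ≡⟨ +-comm N (p * N) ⟩
      p * N + N       ≡⟨ sym s+a≡ ⟩
      s + a           ≤⟨ +-monoʳ-≤ s a≤d ⟩
      s + d           ∎) , (begin-strict
      s + d           <⟨ +-monoʳ-< s d< ⟩
      s + (a + b)     ≡⟨ sym (+-assoc s a b) ⟩
      s + a + b       ≡⟨ cong (_+ b) (trans s+a≡ (+-comm (p * N) N)) ⟩
      suc p * N + b   ≤⟨ +-monoʳ-≤ (suc p * N) b≤N ⟩
      suc p * N + N   ∎)
      where
      a≤d : a ≤ d
      a≤d = ≤-trans a≤1 (n≢0⇒n>0 (λ d≡0 → s+d≢s (trans (cong (s +_) d≡0) (+-identityʳ s))))

  StarBlock-centredAtBoundary : ∀ p {s a b} → s + a ≡ p * N + N → a ≤ N → b ≤ 1 → a + b ≤ 3 →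
                                StarBlock N s (a + b)
  StarBlock-centredAtBoundary p {s} {a} {b} s+a≡ a≤N b≤1 size≤3 =
    record { centre = s + a ; part = p ; offCentre = offCentre ; smallOrFlat = inj₁ size≤3 }
    where
    pN≤s : p * N ≤ s
    pN≤s = +-cancelʳ-≤ N (p * N) s (subst (_≤ s + N) s+a≡ (+-monoʳ-≤ s a≤N))
    offCentre : ∀ d → d < a + b → s + d ≢ s + a → InPart N p (s + d)
    offCentre d d< s+d≢s+a = ≤-trans pN≤s (m≤m+n s d) , subst (s + d <_) s+a≡ (+-monoʳ-< s d<a)
      where
      d≤a : d ≤ a
      d≤a = ≤-pred (<-≤-trans d< (subst (a + b ≤_) (+-comm a 1) (+-monoʳ-≤ a b≤1)))
      d<a : d < a
      d<a = ≤∧≢⇒< d≤a (λ d≡a → s+d≢s+a (cong (s +_) d≡a))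

-- Equitable colourings from block layouts

Near : ℕ → ℕ → Set
Near Q l = Q ≤ l × l ≤ suc Q

All-nth : ∀ {P : ℕ → Set} {L} → All P L → ∀ j → j < length L → P (nth L j)
All-nth (p ∷ _) zero _ = p
All-nth (_ ∷ ps) (suc j) (s≤s j<) = All-nth ps j j<

K3Colorable : ℕ → ℕ → Set
K3Colorable N t = HasEquitableTreeColoring (K3 N) t 3

module BlockColoring {N t L} (Bs : StarLayout N 0 L) (sum≡ : sum L ≡ 3 * N) (length≡ : length L ≡ t) where

  G = K3 N

  inRange : (v : Fin (3 * N)) → toℕ v < sum L
  inRange v = subst (toℕ v <_) (sym sum≡) (toℕ<n v)

  block : Fin (3 * N) → ℕ
  block v = blockOf L (toℕ v)

  block<t : ∀ v → block v < t
  block<t v = subst (block v <_) length≡ (blockOf<length L (toℕ v) (inRange v))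

  colouring : Coloring G t
  colouring v = fromℕ< (block<t v)

  toℕ-colouring : ∀ v → toℕ (colouring v) ≡ block v
  toℕ-colouring v = toℕ-fromℕ< (block<t v)

  sameBlock : ∀ u v → colouring u ≡ colouring v → block u ≡ block v
  sameBlock u v fu≡fv = trans (sym (toℕ-colouring u)) (trans (cong toℕ fu≡fv) (toℕ-colouring v))

  classSize≡nth : ∀ i → classSize G colouring i ≡ nth L (toℕ i)
  classSize≡nth i = trans (length-filter-tabulate colouring id (blockOf L) i toℕ-colouring)
                          (subst (λ M → occurrences (blockOf L) M (toℕ i) ≡ nth L (toℕ i)) sum≡
                                 (occurrences-blockOf L (toℕ i)))

  placed : ∀ v → PlacedIn Bs (block v) (toℕ v)
  placed v = placedIn-blockOf Bs (toℕ v) (inRange v)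

  part : Fin (3 * N) → ℕ
  part v = partOf Bs (block v)

  apart : ∀ u v → adj G u v ≡ true → block u ≡ block v →
          InPart N (part u) (toℕ u) → InPart N (part v) (toℕ v) → ⊥
  apart u v u~v bu≡bv u∈ v∈ with () ← trans (sym u~v)
    (samePart⇒nonadjacent N u v (part u) u∈
                          (subst (λ b → InPart N (partOf Bs b) (toℕ v)) (sym bu≡bv) v∈))

  IsCentre : Fin (3 * N) → Set
  IsCentre v = toℕ v ≡ centreOf Bs (block v)

  covers : ∀ u v → colouring u ≡ colouring v → adj G u v ≡ true → IsCentre u ⊎ IsCentre v
  covers u v fu≡fv u~v with toℕ u ≟ centreOf Bs (block u) | toℕ v ≟ centreOf Bs (block v)
  ... | yes zu | _ = inj₁ zu
  ... | no _ | yes zv = inj₂ zv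
  ... | no ¬zu | no ¬zv =
    ⊥-elim (apart u v u~v (sameBlock u v fu≡fv) (proj₁ (placed u) ¬zu) (proj₁ (placed v) ¬zv))

  unique : ∀ u v → IsCentre u → IsCentre v → colouring u ≡ colouring v → u ≡ v
  unique u v zu zv fu≡fv =
    toℕ-injective (trans zu (trans (cong (centreOf Bs) (sameBlock u v fu≡fv)) (sym zv)))

  small : ∀ u v → colouring u ≡ colouring v → adj G u v ≡ true → classSize G colouring (colouring u) ≤ 3
  small u v fu≡fv u~v rewrite classSize≡nth (colouring u) | toℕ-colouring u
    with proj₂ (placed u) | proj₂ (placed v)
  ... | inj₁ size≤3 | _ = size≤3
  ... | inj₂ _ | inj₁ size≤3 = subst (λ b → nth L b ≤ 3) (sym (sameBlock u v fu≡fv)) size≤3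
  ... | inj₂ u∈ | inj₂ v∈ = ⊥-elim (apart u v u~v (sameBlock u v fu≡fv) u∈ v∈)

  treeColoring : TreeColoring G t 3 colouring
  treeColoring = centred⇒TreeColoring G colouring IsCentre covers unique small

layoutColoring : ∀ {N t Q L} → StarLayout N 0 L → sum L ≡ 3 * N → length L ≡ t → All (Near Q) L →
                 K3Colorable N t
layoutColoring {N} {t} {Q} {L} Bs sum≡ length≡ near = colouring , treeColoring , equitable
  where
  open BlockColoring Bs sum≡ length≡
  near-classSize : ∀ i → Near Q (classSize G colouring i)
  near-classSize i = subst (Near Q) (sym (classSize≡nth i))
                           (All-nth near (toℕ i) (subst (toℕ i <_) (sym length≡) (toℕ<n i)))
  equitable : Equitable G colouring
  equitable i j = ≤-trans (proj₂ (near-classSize i))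
    (subst (_≤ classSize G colouring j + 1) (+-comm Q 1) (+-monoˡ-≤ 1 (proj₁ (near-classSize j))))

record Division (Q n m : ℕ) : Set where
  constructor division
  field
    blocks  : List ℕ
    sum≡    : sum blocks ≡ n
    length≡ : length blocks ≡ m
    near    : All (Near Q) blocks

sum-replicate : ∀ k x → sum (replicate k x) ≡ k * x
sum-replicate zero x = refl
sum-replicate (suc k) x = cong (x +_) (sum-replicate k x)

divide : ∀ Q n m → Q * m ≤ n → n ≤ suc Q * m → Division Q n m
divide Q n m lo hi = division (replicate x (suc Q) ++ replicate y Q) sum≡ length≡ near
  where
  x = n ∸ Q * m
  y = m ∸ x
  x≤m : x ≤ m
  x≤m = subst (x ≤_) (m+n∸n≡m m (Q * m)) (∸-monoˡ-≤ (Q * m) hi)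
  x+y≡m : x + y ≡ m
  x+y≡m = m+[n∸m]≡n x≤m
  sum≡ : sum (replicate x (suc Q) ++ replicate y Q) ≡ n
  sum≡ = begin
    sum (replicate x (suc Q) ++ replicate y Q)        ≡⟨ sum-++ (replicate x (suc Q)) _ ⟩
    sum (replicate x (suc Q)) + sum (replicate y Q)   ≡⟨ cong₂ _+_ (sum-replicate x (suc Q)) (sum-replicate y Q) ⟩
    x * suc Q + y * Q                                 ≡⟨ regroup x y Q ⟩
    x + (x + y) * Q                                   ≡⟨ cong (λ k → x + k * Q) x+y≡m ⟩
    x + m * Q                                         ≡⟨ cong (x +_) (*-comm m Q) ⟩
    x + Q * m                                         ≡⟨ +-comm x (Q * m) ⟩
    Q * m + (n ∸ Q * m)                               ≡⟨ m+[n∸m]≡n lo ⟩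
    n                                                 ∎
    where
    open ≡-Reasoning
    regroup : ∀ x y Q → x * suc Q + y * Q ≡ x + (x + y) * Q
    regroup = solve-∀
  length≡ : length (replicate x (suc Q) ++ replicate y Q) ≡ m
  length≡ = trans (length-++ (replicate x (suc Q)))
                  (trans (cong₂ _+_ (length-replicate x) (length-replicate y)) x+y≡m)
  near : All (Near Q) (replicate x (suc Q) ++ replicate y Q)
  near = ++⁺ (replicate⁺ x (n≤1+n Q , ≤-refl)) (replicate⁺ y (≤-refl , n≤1+n Q))

divideEvenly : ∀ n m .{{_ : NonZero m}} → Division (n / m) n m
divideEvenly n m = divide (n / m) n m (m/n*n≤m n m) (begin
  n                   ≡⟨ m≡m%n+[m/n]*n n m ⟩
  n % m + n / m * m   ≤⟨ +-monoˡ-≤ (n / m * m) (<⇒≤ (m%n<n n m)) ⟩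
  m + n / m * m       ∎)
  where open ≤-Reasoning

m+k≡n⇒m≤n : ∀ {m n} k → m + k ≡ n → m ≤ n
m+k≡n⇒m≤n {m} k m+k≡n = subst (m ≤_) m+k≡n (m≤m+n m k)

pureColoring : ∀ {N t Q mA mB mC} → Division Q N mA → Division Q N mB → Division Q N mC →
               mA + (mB + mC) ≡ t → K3Colorable N t
pureColoring {N} {t} (division A sumA lenA nearA) (division B sumB lenB nearB) (division C sumC lenC nearC) m≡t =
  layoutColoring layout sum≡ length≡ (++⁺ nearA (++⁺ nearB nearC))
  where
  fill : ∀ p {s} L → s ≡ p * N → sum L ≡ N → StarLayout N s L
  fill p L refl sumL≡N = StarLayout-inPart p L ≤-refl (≤-reflexive (cong (p * N +_) sumL≡N))
  N+N≡2*N : ∀ N → N + N ≡ 2 * N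
  N+N≡2*N = solve-∀
  N+[N+N]≡3*N : ∀ N → N + (N + N) ≡ 3 * N
  N+[N+N]≡3*N = solve-∀
  layout : StarLayout N 0 (A ++ B ++ C)
  layout = StarLayout-++ (fill 0 A refl sumA)
             (StarLayout-++ (fill 1 B (trans sumA (sym (*-identityˡ N))) sumB)
                            (fill 2 C (trans (cong₂ _+_ sumA sumB) (N+N≡2*N N)) sumC))
  sum≡ : sum (A ++ B ++ C) ≡ 3 * N
  sum≡ = begin
    sum (A ++ B ++ C)         ≡⟨ sum-++ A (B ++ C) ⟩
    sum A + sum (B ++ C)      ≡⟨ cong (sum A +_) (sum-++ B C) ⟩
    sum A + (sum B + sum C)   ≡⟨ cong₂ _+_ sumA (cong₂ _+_ sumB sumC) ⟩
    N + (N + N)               ≡⟨ N+[N+N]≡3*N N ⟩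
    3 * N                     ∎
    where open ≡-Reasoning
  length≡ : length (A ++ B ++ C) ≡ t
  length≡ = trans (length-++ A) (trans (cong₂ _+_ lenA (trans (length-++ B) (cong₂ _+_ lenB lenC))) m≡t)

Crossing : ℕ → ℕ → Set
Crossing a b = (a ≤ 1 ⊎ b ≤ 1) × a + b ≤ 3

StarBlock-across : ∀ {N} p {s a b} → s + a ≡ p * N + N → a ≤ N → b ≤ N → Crossing a b →
                   StarBlock N s (a + b)
StarBlock-across p s+a≡ _ b≤N (inj₁ a≤1 , size≤3) = StarBlock-centredAtStart p s+a≡ a≤1 b≤N size≤3
StarBlock-across p s+a≡ a≤N _ (inj₂ b≤1 , size≤3) = StarBlock-centredAtBoundary p s+a≡ a≤N b≤1 size≤3

-- Part A holds the blocks A and then a₁ vertices, part B holds b₁ vertices, the blocks B and a₂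
-- vertices, and part C holds b₂ vertices and the blocks C; a₁ + b₁ and a₂ + b₂ are the two blocks
-- crossing a boundary.
module CrossingLayout {N} (A B C : List ℕ) (a₁ b₁ a₂ b₂ : ℕ)
  (hA : sum A + a₁ ≡ N) (hB : b₁ + sum B + a₂ ≡ N) (hC : b₂ + sum C ≡ N) where

  blocks : List ℕ
  blocks = A ++ (a₁ + b₁) ∷ (B ++ (a₂ + b₂) ∷ C)

  private
    α = sum A
    β = sum B
    γ = sum C
    sB = α + (a₁ + b₁)
    sC = sB + β + (a₂ + b₂)

    sB≡ : sB ≡ N + b₁
    sB≡ = trans (sym (+-assoc α a₁ b₁)) (cong (_+ b₁) hA)

    secondBoundary : sB + β + a₂ ≡ N + N
    secondBoundary = begin
      sB + β + a₂       ≡⟨ cong (λ s → s + β + a₂) sB≡ ⟩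
      N + b₁ + β + a₂   ≡⟨ cong (_+ a₂) (+-assoc N b₁ β) ⟩
      N + (b₁ + β) + a₂ ≡⟨ +-assoc N (b₁ + β) a₂ ⟩
      N + (b₁ + β + a₂) ≡⟨ cong (N +_) hB ⟩
      N + N             ∎
      where open ≡-Reasoning

    sC≡ : sC ≡ N + N + b₂
    sC≡ = trans (sym (+-assoc (sB + β) a₂ b₂)) (cong (_+ b₂) secondBoundary)

    end≡ : sC + γ ≡ N + N + N
    end≡ = trans (cong (_+ γ) sC≡) (trans (+-assoc (N + N) b₂ γ) (cong (N + N +_) hC))

    N≡1*N : N ≡ 1 * N
    N≡1*N = sym (*-identityˡ N)

    N+N≡2*N : N + N ≡ 2 * N
    N+N≡2*N = cong (N +_) N≡1*N

    ˡ≤N : ∀ {x y} → x + y ≡ N → x ≤ N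
    ˡ≤N {x} {y} = m+k≡n⇒m≤n y
    ʳ≤N : ∀ {x y} → x + y ≡ N → y ≤ N
    ʳ≤N {x} {y} eq = m+k≡n⇒m≤n x (trans (+-comm y x) eq)

  crossingLayout : Crossing a₁ b₁ → Crossing a₂ b₂ → StarLayout N 0 blocks
  crossingLayout cross₁ cross₂ =
    StarLayout-++ (StarLayout-inPart 0 A z≤n (ˡ≤N hA))
      (StarBlock-across 0 hA (ʳ≤N hA) (≤-trans (m≤m+n b₁ β) (ˡ≤N hB)) cross₁
       ∷ StarLayout-++ (StarLayout-inPart 1 B B-lo B-hi)
           (StarBlock-across 1 (trans secondBoundary (cong (_+ N) N≡1*N)) (ʳ≤N hB) (ˡ≤N hC) cross₂
            ∷ StarLayout-inPart 2 C (subst₂ _≤_ N+N≡2*N (sym sC≡) (m≤m+n (N + N) b₂))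
                                    (≤-reflexive (trans end≡ (cong (_+ N) N+N≡2*N)))))
    where
    B-lo : 1 * N ≤ sB
    B-lo = subst₂ _≤_ N≡1*N (sym sB≡) (m≤m+n N b₁)
    B-hi : sB + β ≤ 1 * N + N
    B-hi = m+k≡n⇒m≤n a₂ (trans secondBoundary (cong (_+ N) N≡1*N))

  sum-blocks : sum blocks ≡ 3 * N
  sum-blocks = begin
    sum blocks                                   ≡⟨ sum-++ A _ ⟩
    α + (a₁ + b₁ + sum (B ++ (a₂ + b₂) ∷ C))     ≡⟨ cong (λ x → α + (a₁ + b₁ + x)) (sum-++ B _) ⟩
    α + (a₁ + b₁ + (β + (a₂ + b₂ + γ)))          ≡⟨ reassociate α (a₁ + b₁) β (a₂ + b₂) γ ⟩
    sC + γ                                       ≡⟨ end≡ ⟩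
    N + N + N                                    ≡⟨ N+N+N≡3*N N ⟩
    3 * N                                        ∎
    where
    open ≡-Reasoning
    reassociate : ∀ a b c d e → a + (b + (c + (d + e))) ≡ a + b + c + d + e
    reassociate = solve-∀
    N+N+N≡3*N : ∀ N → N + N + N ≡ 3 * N
    N+N+N≡3*N = solve-∀

crossingColoring : ∀ {N t Q nA nB nC mA mB mC} a₁ b₁ a₂ b₂ →
                   Division Q nA mA → Division Q nB mB → Division Q nC mC →
                   nA + a₁ ≡ N → b₁ + nB + a₂ ≡ N → b₂ + nC ≡ N →
                   Crossing a₁ b₁ → Crossing a₂ b₂ → Near Q (a₁ + b₁) → Near Q (a₂ + b₂) →
                   mA + suc (mB + suc mC) ≡ t → K3Colorable N t
crossingColoring a₁ b₁ a₂ b₂ (division A refl lenA nearA) (division B refl lenB nearB)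
  (division C refl lenC nearC) hA hB hC cross₁ cross₂ near₁ near₂ m≡t =
  layoutColoring (crossingLayout cross₁ cross₂) sum-blocks length≡
                 (++⁺ nearA (near₁ ∷ ++⁺ nearB (near₂ ∷ nearC)))
  where
  open CrossingLayout A B C a₁ b₁ a₂ b₂ hA hB hC
  length≡ : length blocks ≡ _
  length≡ = trans (length-++ A)
    (trans (cong₂ (λ x y → x + suc y) lenA (trans (length-++ B) (cong (_+ suc (length C)) lenB)))
           (trans (cong (λ c → _ + suc (_ + suc c)) lenC) m≡t))

-- The four layouts with Q = 2; the block sizes from left to right are written as 3ᵏ (k blocks of
-- size 3) and a + b for a block crossing a boundary.

threes : ∀ m → Division 3 (3 * m) m
threes m = divide 3 (3 * m) m ≤-refl (*-monoˡ-≤ m (n≤1+n 3))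

-- 3ᵐ, 1 + 2, 3ᵐ⁻¹, 2 + 1, 3ᵐ
coloring[3m+1,3m+1] : ∀ m → 1 ≤ m → K3Colorable (1 + 3 * m) (1 + 3 * m)
coloring[3m+1,3m+1] (suc k) _ =
  crossingColoring 1 2 2 1 (threes (suc k)) (threes k) (threes (suc k)) (hA k) (hB k) refl
    (inj₁ ≤-refl , ≤-refl) (inj₂ ≤-refl , ≤-refl) (≤-refl , n≤1+n 3) (≤-refl , n≤1+n 3) (len k)
  where
  hA : ∀ k → 3 * suc k + 1 ≡ 1 + 3 * suc k
  hA = solve-∀
  hB : ∀ k → 2 + 3 * k + 2 ≡ 1 + 3 * suc k
  hB = solve-∀
  len : ∀ k → suc k + suc (k + suc (suc k)) ≡ 1 + 3 * suc k
  len = solve-∀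

-- 3ᵐ⁻¹ 2, 2 + 0, 3ᵐ, 1 + 1, 3ᵐ
coloring[3m+1,3m+2] : ∀ m → 1 ≤ m → K3Colorable (1 + 3 * m) (2 + 3 * m)
coloring[3m+1,3m+2] (suc k) _ =
  crossingColoring 2 0 1 1 (divide 2 (3 * k + 2) (suc k) (m+k≡n⇒m≤n k (loA k)) (m+k≡n⇒m≤n 1 (hiA k)))
    (divide 2 (3 * suc k) (suc k) (m+k≡n⇒m≤n (suc k) (lo k)) ≤-refl)
    (divide 2 (3 * suc k) (suc k) (m+k≡n⇒m≤n (suc k) (lo k)) ≤-refl) (hA k) (hB k) refl
    (inj₂ z≤n , n≤1+n 2) (inj₁ ≤-refl , n≤1+n 2) (≤-refl , n≤1+n 2) (≤-refl , n≤1+n 2) (len k)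
  where
  loA : ∀ k → 2 * suc k + k ≡ 3 * k + 2
  loA = solve-∀
  hiA : ∀ k → 3 * k + 2 + 1 ≡ 3 * suc k
  hiA = solve-∀
  lo : ∀ k → 2 * suc k + suc k ≡ 3 * suc k
  lo = solve-∀
  hA : ∀ k → 3 * k + 2 + 2 ≡ 1 + 3 * suc k
  hA = solve-∀
  hB : ∀ k → 0 + 3 * suc k + 1 ≡ 1 + 3 * suc k
  hB = solve-∀
  len : ∀ k → suc k + suc (suc k + suc (suc k)) ≡ 2 + 3 * suc k
  len = solve-∀

-- 4 4 3ᵐ⁻², 0 + 3, 4 3ᵐ⁻², 1 + 2, 3ᵐ
coloring[3m+2,3m+1] : ∀ m → 2 ≤ m → K3Colorable (2 + 3 * m) (1 + 3 * m)
coloring[3m+2,3m+1] (suc zero) (s≤s ())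
coloring[3m+2,3m+1] (suc (suc k)) _ =
  crossingColoring 0 3 1 2 (divide 3 (3 * k + 8) (2 + k) (m+k≡n⇒m≤n 2 (loA k)) (m+k≡n⇒m≤n k (hiA k)))
    (divide 3 (3 * k + 4) (1 + k) (m+k≡n⇒m≤n 1 (loB k)) (m+k≡n⇒m≤n k (hiB k))) (threes (2 + k))
    (hA k) (hB k) refl
    (inj₁ z≤n , ≤-refl) (inj₁ ≤-refl , ≤-refl) (≤-refl , n≤1+n 3) (≤-refl , n≤1+n 3) (len k)
  where
  loA : ∀ k → 3 * (2 + k) + 2 ≡ 3 * k + 8
  loA = solve-∀
  hiA : ∀ k → 3 * k + 8 + k ≡ 4 * (2 + k)
  hiA = solve-∀
  loB : ∀ k → 3 * (1 + k) + 1 ≡ 3 * k + 4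
  loB = solve-∀
  hiB : ∀ k → 3 * k + 4 + k ≡ 4 * (1 + k)
  hiB = solve-∀
  hA : ∀ k → 3 * k + 8 + 0 ≡ 2 + 3 * (2 + k)
  hA = solve-∀
  hB : ∀ k → 3 + (3 * k + 4) + 1 ≡ 2 + 3 * (2 + k)
  hB = solve-∀
  len : ∀ k → 2 + k + suc (1 + k + suc (2 + k)) ≡ 1 + 3 * (2 + k)
  len = solve-∀

-- 3ᵐ, 2 + 1, 3ᵐ, 1 + 2, 3ᵐ
coloring[3m+2,3m+2] : ∀ m → K3Colorable (2 + 3 * m) (2 + 3 * m)
coloring[3m+2,3m+2] m =
  crossingColoring 2 1 1 2 (threes m) (threes m) (threes m) (hA m) (hB m) refl
    (inj₂ ≤-refl , ≤-refl) (inj₁ ≤-refl , ≤-refl) (≤-refl , n≤1+n 3) (≤-refl , n≤1+n 3) (len m)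
  where
  hA : ∀ m → 3 * m + 2 ≡ 2 + 3 * m
  hA = solve-∀
  hB : ∀ m → 1 + 3 * m + 1 ≡ 2 + 3 * m
  hB = solve-∀
  len : ∀ m → m + suc (m + suc m) ≡ 2 + 3 * m
  len = solve-∀

-- The case analysis

¬∣offset : ∀ {d c} m → 0 < c → c < d → ¬ d ∣ d * m + c
¬∣offset {d} {c} m 0<c c<d d∣ = <⇒≱ c<d (∣⇒≤ {{>-nonZero 0<c}} (∣m+n∣m⇒∣n d∣ (m∣m*n m)))

5*t<15*[1+m] : ∀ {t} e m → t ≡ e + 3 * m → e ≤ 2 → 5 * t < 15 * suc m
5*t<15*[1+m] {t} e m t≡ e≤2 = begin-strict
  5 * t             ≡⟨ cong (5 *_) t≡ ⟩
  5 * (e + 3 * m)   ≡⟨ expand e m ⟩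
  5 * e + 15 * m    ≤⟨ +-monoˡ-≤ (15 * m) (*-monoʳ-≤ 5 e≤2) ⟩
  10 + 15 * m       <⟨ +-monoˡ-< (15 * m) (s≤s (m≤m+n 10 4)) ⟩
  15 + 15 * m       ≡⟨ sym (*-suc 15 m) ⟩
  15 * suc m        ∎
  where
  open ≤-Reasoning
  expand : ∀ e m → 5 * (e + 3 * m) ≡ 5 * e + 15 * m
  expand = solve-∀

overfull-split : ∀ {N Q s m} → N ≡ s + Q * suc m → s ≤ m → m < Q + s →
                 Σ ℕ λ c → N ≡ c + suc Q * m × 1 ≤ c × c ≤ Q
overfull-split {N} {Q} {s} {m} N≡ s≤m m<Q+s = c , N≡′ , 1≤c , c≤Q
  where
  c = Q + s ∸ m
  m+c≡ : m + c ≡ Q + s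
  m+c≡ = m+[n∸m]≡n (<⇒≤ m<Q+s)
  N≡′ : N ≡ c + suc Q * m
  N≡′ = begin
    N               ≡⟨ N≡ ⟩
    s + Q * suc m   ≡⟨ regroup s Q m ⟩
    Q + s + Q * m   ≡⟨ cong (_+ Q * m) (sym m+c≡) ⟩
    m + c + Q * m   ≡⟨ regroup′ m c Q ⟩
    c + suc Q * m   ∎
    where
    open ≡-Reasoning
    regroup : ∀ s Q m → s + Q * suc m ≡ Q + s + Q * m
    regroup = solve-∀
    regroup′ : ∀ m c Q → m + c + Q * m ≡ c + suc Q * m
    regroup′ = solve-∀
  1≤c : 1 ≤ c
  1≤c = +-cancelˡ-< m 0 c (subst₂ _<_ (sym (+-identityʳ m)) (sym m+c≡) m<Q+s)
  c≤Q : c ≤ Q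
  c≤Q = subst (c ≤_) (m+n∸n≡m Q m) (∸-monoˡ-≤ m (+-monoʳ-≤ Q s≤m))

module _ {N t ρ : ℕ} (4∣N : 4 ∣ N) (5∣N+ρ : 5 ∣ N + ρ) (1≤ρ : 1 ≤ ρ)
         (bound : 3 * N + 3 * ρ ≤ 5 * t) where

  tooFewColours : ∀ e m → t ≡ e + 3 * m → e ≤ 2 → 15 * suc m ≤ 3 * N + 3 * ρ → ⊥
  tooFewColours e m t≡ e≤2 big = <⇒≱ (5*t<15*[1+m] e m t≡ e≤2) (≤-trans big bound)

  N≢c+4*m : ∀ m c → N ≡ c + 4 * m → 0 < c → c < 4 → ⊥
  N≢c+4*m m c N≡ 0<c c<4 = ¬∣offset m 0<c c<4 (subst (4 ∣_) (trans N≡ (+-comm c (4 * m))) 4∣N)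

  exceptional-Q≡2 : ∀ m c e → t ≡ e + 3 * m → 1 ≤ e → e ≤ 2 → N ≡ c + 3 * m → 1 ≤ c → c ≤ 2 →
                    K3Colorable N t
  exceptional-Q≡2 zero 1 e _ _ _ N≡ _ _ = ⊥-elim (N≢c+4*m 0 1 N≡ (s≤s z≤n) (s≤s (s≤s z≤n)))
  exceptional-Q≡2 (suc k) 1 1 t≡ _ _ N≡ _ _ =
    subst₂ K3Colorable (sym N≡) (sym t≡) (coloring[3m+1,3m+1] (suc k) (s≤s z≤n))
  exceptional-Q≡2 (suc k) 1 2 t≡ _ _ N≡ _ _ =
    subst₂ K3Colorable (sym N≡) (sym t≡) (coloring[3m+1,3m+2] (suc k) (s≤s z≤n))
  exceptional-Q≡2 zero 2 1 _ _ _ N≡ _ _ = ⊥-elim (N≢c+4*m 0 2 N≡ (s≤s z≤n) (s≤s (s≤s (s≤s z≤n))))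
  exceptional-Q≡2 1 2 1 _ _ _ N≡ _ _ = ⊥-elim (N≢c+4*m 1 1 N≡ (s≤s z≤n) (s≤s (s≤s z≤n)))
  exceptional-Q≡2 (suc (suc k)) 2 1 t≡ _ _ N≡ _ _ =
    subst₂ K3Colorable (sym N≡) (sym t≡) (coloring[3m+2,3m+1] (suc (suc k)) (s≤s (s≤s z≤n)))
  exceptional-Q≡2 m 2 2 t≡ _ _ N≡ _ _ = subst₂ K3Colorable (sym N≡) (sym t≡) (coloring[3m+2,3m+2] m)
  exceptional-Q≡2 m c zero _ () _ _ _ _
  exceptional-Q≡2 m c (suc (suc (suc e))) _ _ (s≤s (s≤s ())) _ _ _
  exceptional-Q≡2 m zero e _ _ _ _ () _
  exceptional-Q≡2 m (suc (suc (suc c))) e _ _ _ _ _ (s≤s (s≤s ()))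

  exceptional : ∀ Q m c e → t ≡ e + 3 * m → 1 ≤ e → e ≤ 2 →
                N ≡ c + suc Q * m → 1 ≤ c → c ≤ Q → Q * suc m ≤ N → K3Colorable N t
  exceptional 0 m c e _ _ _ _ 1≤c c≤0 _ = ⊥-elim (<⇒≱ 1≤c c≤0)
  exceptional 1 m c e _ _ _ N≡ 1≤c c≤1 _ = ⊥-elim (¬∣offset m (s≤s z≤n) (s≤s (s≤s z≤n)) 2∣2m+1)
    where
    2∣2m+1 : 2 ∣ 2 * m + 1
    2∣2m+1 = subst (2 ∣_) (trans N≡ (trans (cong (_+ 2 * m) (≤-antisym c≤1 1≤c)) (+-comm 1 (2 * m))))
                (∣-trans (divides 2 refl) 4∣N)
  exceptional 2 m c e t≡ 1≤e e≤2 N≡ 1≤c c≤2 _ = exceptional-Q≡2 m c e t≡ 1≤e e≤2 N≡ 1≤c c≤2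
  exceptional 3 m c e _ _ _ N≡ 1≤c c≤3 _ = ⊥-elim (N≢c+4*m m c N≡ 1≤c (s≤s c≤3))
  exceptional 4 m c e t≡ _ e≤2 N≡ 1≤c _ _ = ⊥-elim (tooFewColours e m t≡ e≤2 (begin
    15 * suc m              ≡⟨ regroup m ⟩
    15 * m + 3 * 5          ≤⟨ +-monoʳ-≤ (15 * m) (*-monoʳ-≤ 3 5≤c+ρ) ⟩
    15 * m + 3 * (c + ρ)    ≡⟨ regroup′ m c ρ ⟩
    3 * (c + 5 * m) + 3 * ρ ≡⟨ cong (λ n → 3 * n + 3 * ρ) (sym N≡) ⟩
    3 * N + 3 * ρ           ∎))
    where
    open ≤-Reasoning
    regroup : ∀ m → 15 * suc m ≡ 15 * m + 3 * 5
    regroup = solve-∀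
    regroup′ : ∀ m c ρ → 15 * m + 3 * (c + ρ) ≡ 3 * (c + 5 * m) + 3 * ρ
    regroup′ = solve-∀
    shuffle : ∀ c m ρ → c + 5 * m + ρ ≡ 5 * m + (c + ρ)
    shuffle = solve-∀
    5∣c+ρ : 5 ∣ c + ρ
    5∣c+ρ = ∣m+n∣m⇒∣n (subst (5 ∣_) (trans (cong (_+ ρ) N≡) (shuffle c m ρ)) 5∣N+ρ) (m∣m*n m)
    5≤c+ρ : 5 ≤ c + ρ
    5≤c+ρ = ∣⇒≤ {{>-nonZero (+-mono-≤ 1≤c z≤n)}} 5∣c+ρ
  exceptional Q@(suc (suc (suc (suc (suc _))))) m c e t≡ _ e≤2 _ _ _ Q*[1+m]≤N =
    ⊥-elim (tooFewColours e m t≡ e≤2 (begin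
    15 * suc m          ≡⟨ *-assoc 3 5 (suc m) ⟩
    3 * (5 * suc m)     ≤⟨ *-monoʳ-≤ 3 (*-monoˡ-≤ (suc m) {5} {Q} (s≤s (s≤s (s≤s (s≤s (s≤s z≤n)))))) ⟩
    3 * (Q * suc m)     ≤⟨ *-monoʳ-≤ 3 Q*[1+m]≤N ⟩
    3 * N               ≤⟨ m≤m+n (3 * N) (3 * ρ) ⟩
    3 * N + 3 * ρ       ∎))
    where open ≤-Reasoning

  unevenColours : ∀ e m → t ≡ e + 3 * m → 1 ≤ e → e ≤ 2 → K3Colorable N t
  unevenColours e m t≡ 1≤e e≤2 with N / suc m + N % suc m ≤? m
  ... | no m≮Q+s =
    let (c , N≡ , 1≤c , c≤Q) =
          overfull-split (m≡m%n+[m/n]*n N (suc m)) (≤-pred (m%n<n N (suc m))) (≰⇒> m≮Q+s)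
    in exceptional (N / suc m) m c e t≡ 1≤e e≤2 N≡ 1≤c c≤Q (m/n*n≤m N (suc m))
  ... | yes Q+s≤m = byCount e 1≤e e≤2 t≡
    where
    Q = N / suc m
    s = N % suc m
    N≡s+Q*[1+m] : N ≡ s + Q * suc m
    N≡s+Q*[1+m] = m≡m%n+[m/n]*n N (suc m)
    D₊ : Division Q N (suc m)
    D₊ = divideEvenly N (suc m)
    D : Division Q N m
    D = divide Q N m (≤-trans (*-monoʳ-≤ Q (n≤1+n m)) (m/n*n≤m N (suc m))) (begin
      N                 ≡⟨ N≡s+Q*[1+m] ⟩
      s + Q * suc m     ≡⟨ regroup s Q m ⟩
      (Q + s) + Q * m   ≤⟨ +-monoˡ-≤ (Q * m) Q+s≤m ⟩
      m + Q * m         ∎)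
      where
      open ≤-Reasoning
      regroup : ∀ s Q m → s + Q * suc m ≡ (Q + s) + Q * m
      regroup = solve-∀
    byCount : ∀ e → 1 ≤ e → e ≤ 2 → t ≡ e + 3 * m → K3Colorable N t
    byCount 1 _ _ t≡ = pureColoring D₊ D D (trans (count m) (sym t≡))
      where
      count : ∀ m → suc m + (m + m) ≡ 1 + 3 * m
      count = solve-∀
    byCount 2 _ _ t≡ = pureColoring D₊ D₊ D (trans (count m) (sym t≡))
      where
      count : ∀ m → suc m + (suc m + m) ≡ 2 + 3 * m
      count = solve-∀
    byCount zero () _ _
    byCount (suc (suc (suc _))) _ (s≤s (s≤s ())) _

  K3-coloring : K3Colorable N t
  K3-coloring = byResidue (t % 3) (t / 3) (m%n<n t 3)
                          (trans (m≡m%n+[m/n]*n t 3) (cong (t % 3 +_) (*-comm (t / 3) 3)))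
    where
    byResidue : ∀ e m → e < 3 → t ≡ e + 3 * m → K3Colorable N t
    byResidue zero zero _ refl = ⊥-elim (<⇒≱ (≤-trans (s≤s z≤n) (*-monoʳ-≤ 3 1≤ρ))
                                             (≤-trans (m≤n+m (3 * ρ) (3 * N)) bound))
    byResidue zero (suc m) _ t≡ = pureColoring D D D (trans (count m) (sym t≡))
      where
      D = divideEvenly N (suc m)
      count : ∀ m → suc m + (suc m + suc m) ≡ 0 + 3 * suc m
      count = solve-∀
    byResidue (suc e) m (s≤s (s≤s e≤1)) t≡ = unevenColours (suc e) m t≡ (s≤s z≤n) (s≤s e≤1)


arboricity≤ : ∀ k ρ → 1 ≤ ρ → k % 5 ≡ ρ →
              StrongEqVertexArboricityAtMost (K3 (4 * k)) 3 ((12 * k + 3 * ρ) / 5)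
arboricity≤ k ρ 1≤ρ k%5≡ρ t bound/5≤t = K3-coloring (m∣m*n k) 5∣4k+ρ 1≤ρ bound
  where
  a = k / 5
  5∣4k+ρ : 5 ∣ 4 * k + ρ
  5∣4k+ρ = divides (4 * a + ρ) (begin
    4 * k + ρ                 ≡⟨ cong (λ k → 4 * k + ρ) (trans (m≡m%n+[m/n]*n k 5) (cong (_+ a * 5) k%5≡ρ)) ⟩
    4 * (ρ + a * 5) + ρ       ≡⟨ regroup ρ a ⟩
    (4 * a + ρ) * 5           ∎)
    where
    open ≡-Reasoning
    regroup : ∀ ρ a → 4 * (ρ + a * 5) + ρ ≡ (4 * a + ρ) * 5
    regroup = solve-∀
  5∣12k+3ρ : 5 ∣ 12 * k + 3 * ρ
  5∣12k+3ρ = subst (5 ∣_) (regroup k ρ) (∣-trans 5∣4k+ρ (n∣m*n 3))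
    where
    regroup : ∀ k ρ → 3 * (4 * k + ρ) ≡ 12 * k + 3 * ρ
    regroup = solve-∀
  bound : 3 * (4 * k) + 3 * ρ ≤ 5 * t
  bound = begin
    3 * (4 * k) + 3 * ρ         ≡⟨ cong (_+ 3 * ρ) (sym (*-assoc 3 4 k)) ⟩
    12 * k + 3 * ρ              ≡⟨ sym (m/n*n≡m 5∣12k+3ρ) ⟩
    (12 * k + 3 * ρ) / 5 * 5    ≤⟨ *-monoˡ-≤ 5 bound/5≤t ⟩
    t * 5                       ≡⟨ *-comm t 5 ⟩
    5 * t                       ∎
    where open ≤-Reasoning

corollary1 : (k : ℕ) → .{{_ : NonZero k}} →
    ((k % 5 ≡ 1) → StrongEqVertexArboricityAtMost (K3 (4 * k)) 3 ((12 * k + 3) / 5)) ×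
    ((k % 5 ≡ 2) → StrongEqVertexArboricityAtMost (K3 (4 * k)) 3 ((12 * k + 6) / 5)) ×
    ((k % 5 ≡ 3) → StrongEqVertexArboricityAtMost (K3 (4 * k)) 3 ((12 * k + 9) / 5)) ×
    ((k % 5 ≡ 4) → StrongEqVertexArboricityAtMost (K3 (4 * k)) 3 ((12 * k + 12) / 5))
corollary1 k = arboricity≤ k 1 0<1+n , arboricity≤ k 2 0<1+n , arboricity≤ k 3 0<1+n , arboricity≤ k 4 0<1+n
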